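{- Let $n,d$ be positive integers and let $g\in\mathbb{F}_q[x]$ be a monic polynomial of degree $\delta\le d$. Then $$\mu_q(n,1,d;(g))=\begin{cases}q^{n(d-\delta)}\left(1-q^{1-n}\right)&\text{if }\delta<d,\\ 1&\text{if }\delta=d.\end{cases}$$
   Context: $M_q(n,1,d)$ is the set of $n\times1$ matrices (column vectors) over $\mathbb{F}_q[x]$ of the form $x^dI+x^{d-1}C_{d-1}+\cdots+C_0$ with $C_i\in M_{n,1}(\mathbb{F}_q)$, where $I$ is the $n\times1$ column with first entry $1$ and all other entries $0$ (for $d=0$ this is the single column $I$). Each $P\in M_q(n,1,d)$ is equivalent (i.e. $APB$ with invertible $A\in M_n(\mathbb{F}_q[x])$, $B\in M_1(\mathbb{F}_q[x])$) to a unique $\mathrm{diag}_{n,1}(p)$ with $p$ monic (its Smith normal form); $(p)$ is the invariant factor of $P$, equal to the monic gcd of its entries. $\mu_q(n,1,d;(g))$ is the number of $P\in M_q(n,1,d)$ with invariant factor $(g)$. -}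

module Defs where

open import Level using (0ℓ)
open import Data.Nat using (ℕ; zero; suc)
open import Data.Fin using (Fin; zero; suc)
open import Data.List using (List; []; _∷_; _++_; [_]; length)
open import Data.Vec using (Vec; lookup; map; toList)
open import Data.Product using (Σ; _×_)
open import Data.Empty using (⊥)
open import Relation.Nullary using (¬_)
open import Relation.Binary.PropositionalEquality using (_≡_)
open import Algebra.Structures using (IsCommutativeRing)
open import Data.List.Relation.Unary.Unique.Propositional using (Unique)
open import Data.List.Membership.Propositional using (_∈_)
open import Function.Bundles using (_⇔_)

record FiniteField (q : ℕ) : Set where
  field
    _+_ _*_ : Fin q → Fin q → Fin q
    -_      : Fin q → Fin q
    0# 1#   : Fin q
    isCommutativeRing : IsCommutativeRing _≡_ _+_ _*_ -_ 0# 1#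
    0≢1     : ¬ (0# ≡ 1#)
    _⁻¹     : Fin q → Fin q
    inverseʳ : ∀ a → ¬ (a ≡ 0#) → (a * (a ⁻¹)) ≡ 1#

module PolyOver {q : ℕ} (F : FiniteField q) where
  open FiniteField F

  -- polynomials over F_q as coefficient lists, lowest degree first
  Poly : Set
  Poly = List (Fin q)

  coeff : Poly → ℕ → Fin q
  coeff []       _       = 0#
  coeff (a ∷ p)  zero    = a
  coeff (a ∷ p)  (suc i) = coeff p i

  -- equality of polynomials (ignores trailing zero coefficients)
  _≈ₚ_ : Poly → Poly → Set
  p ≈ₚ r = ∀ i → coeff p i ≡ coeff r i

  _+ₚ_ : Poly → Poly → Poly
  []      +ₚ r       = r
  (a ∷ p) +ₚ []      = a ∷ p
  (a ∷ p) +ₚ (b ∷ r) = (a + b) ∷ (p +ₚ r)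

  scale : Fin q → Poly → Poly
  scale a []      = []
  scale a (b ∷ r) = (a * b) ∷ scale a r

  _*ₚ_ : Poly → Poly → Poly
  []      *ₚ r = []
  (a ∷ p) *ₚ r = scale a r +ₚ (0# ∷ (p *ₚ r))

  _∣ₚ_ : Poly → Poly → Set
  a ∣ₚ b = Σ Poly (λ c → (a *ₚ c) ≈ₚ b)

  monic : {k : ℕ} → Vec (Fin q) k → Poly
  monic c = toList c ++ [ 1# ]

  -- An element of M_q(n,1,d) is x^d I + x^{d-1} C_{d-1} + ... + C_0,
  -- determined by (C_0, ..., C_{d-1}); here C : Vec (Vec F n) d with
  -- lookup C i = C_i.  entry C k is the k-th entry of the column.
  entry : {n d : ℕ} → Vec (Vec (Fin q) n) d → Fin n → Poly
  entry C zero    = monic (map (λ Ci → lookup Ci zero) C)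
  entry C (suc k) = toList (map (λ Ci → lookup Ci (suc k)) C)

  -- g is a (the) greatest common divisor of the entries: g divides every
  -- entry, and every common divisor of the entries divides g.  For monic g
  -- this says (g) is the invariant factor of P.
  IsGcdOfEntries : {n d : ℕ} → Poly → Vec (Vec (Fin q) n) d → Set
  IsGcdOfEntries {n} g C =
    (∀ k → g ∣ₚ entry C k) × (∀ h → (∀ k → h ∣ₚ entry C k) → h ∣ₚ g)

IsCount : {A : Set} → (A → Set) → ℕ → Set
IsCount {A} P N =
  Σ (List A) (λ xs → Unique xs × (length xs ≡ N) × (∀ x → P x ⇔ (x ∈ xs)))

module Submission where

-- Over a field, a column P whose first entry is monic has a monic gcd g, which Euclid's algorithm
-- finds inside the ideal generated by the entries of P.  Hence P = g · R for a unique column R with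
-- coprime entries and deg R = deg P − deg g, so the columns of degree d with a prescribed gcd g are
-- counted by c(d − deg g), where c(j) is the number of coprime columns of degree j.  Summing over
-- the degree k of the gcd gives q^(nd) = Σ_{k ≤ d} q^k c(d − k), and this recursion solves to
-- c(0) = 1 and c(j) = q^(nj) − q^(n(j−1)+1) for j ≥ 1.

open import Defs
open import Data.Nat using (ℕ)

module Counting where

  open import Data.Nat using (zero; suc; _+_; _*_; _∸_; _^_)
  open import Data.Nat.Properties using (+-comm; m+n∸n≡m; +-*-semiring)
  open import Data.Fin.Properties using (suc-injective; 0≢1+n)
  open import Data.Fin using (Fin; zero; suc)
  open import Data.Vec as Vec using (Vec)
  open import Data.Vec.Properties using (∷-injective)
  open import Data.List using (List; []; _∷_; _++_; length; map; filter; allFin; cartesianProduct)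
  open import Data.List.Properties using (length-map; length-++; length-tabulate)
  open import Data.List.Relation.Unary.Any using (here)
  open import Data.List.Relation.Unary.All using (All; []; _∷_)
  import Data.List.Relation.Unary.All as All
  import Data.List.Relation.Unary.All.Properties as Allₚ
  open import Data.List.Relation.Unary.AllPairs using ([]; _∷_)
  open import Data.List.Relation.Unary.Unique.Propositional using (Unique)
  import Data.List.Relation.Unary.Unique.Propositional.Properties as Unique
  open import Data.List.Membership.Propositional using (_∈_)
  open import Data.List.Membership.Propositional.Properties
    using (∈-map⁺; ∈-map⁻; ∈-++⁺ˡ; ∈-++⁺ʳ; ∈-++⁻; ∈-filter⁺; ∈-filter⁻; ∈-allFin; ∈-cartesianProduct⁺; ∈-cartesianProduct⁻)
  open import Data.List.Membership.Propositional.Properties.WithK using (unique∧set⇒bag)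
  open import Data.List.Relation.Binary.BagAndSetEquality using (∼bag⇒↭)
  open import Data.List.Relation.Binary.Permutation.Propositional.Properties using (↭-length)
  open import Data.Product using (∃-syntax; _×_; _,_; proj₂; uncurry)
  open import Data.Sum using (_⊎_; inj₁; inj₂; [_,_])
  open import Data.Unit using (⊤; tt)
  open import Data.Empty using (⊥)
  open import Relation.Nullary using (¬?; Dec)
  import Relation.Nullary.Decidable as Dec
  open import Relation.Unary using (∁)
  open import Relation.Binary using (DecidableEquality)
  open import Relation.Binary.PropositionalEquality hiding ([_])
  open import Function.Base using (_∘_)
  open import Function.Bundles using (_⇔_; mk⇔; Equivalence)
  open import Algebra.Properties.Semiring.Sum +-*-semiring using (sum)

  open Equivalence using (to; from)

  private variable
    A B : Set
    P Q : A → Set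
    a b : ℕ

  IsCount-unique : IsCount P a → IsCount P b → a ≡ b
  IsCount-unique (xs , uxs , refl , ∈xs) (ys , uys , refl , ∈ys) =
    ↭-length (∼bag⇒↭ (unique∧set⇒bag uxs uys
      (mk⇔ (λ x∈xs → to (∈ys _) (from (∈xs _) x∈xs)) (λ x∈ys → to (∈xs _) (from (∈ys _) x∈ys)))))

  IsCount-resp : (∀ x → P x ⇔ Q x) → IsCount P a → IsCount Q a
  IsCount-resp P⇔Q (xs , uxs , len , ∈xs) =
    xs , uxs , len , λ x → mk⇔ (λ Qx → to (∈xs x) (from (P⇔Q x) Qx)) (λ x∈xs → to (P⇔Q x) (from (∈xs x) x∈xs))

  Unique-map⁺-on : (f : A → B) {xs : List A} → All P xs → (∀ {x y} → P x → P y → f x ≡ f y → x ≡ y) →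
                   Unique xs → Unique (map f xs)
  Unique-map⁺-on f [] f-inj [] = []
  Unique-map⁺-on f (Px ∷ Pxs) f-inj (x∉xs ∷ uxs) =
    Allₚ.map⁺ (All.zipWith (λ (x≢y , Py) fx≡fy → x≢y (f-inj Px Py fx≡fy)) (x∉xs , Pxs))
    ∷ Unique-map⁺-on f Pxs f-inj uxs

  IsCount-image : (f : A → B) → IsCount P a → (∀ {x y} → P x → P y → f x ≡ f y → x ≡ y) →
                  IsCount (λ y → ∃[ x ] P x × f x ≡ y) a
  IsCount-image {P = P} f (xs , uxs , len , ∈xs) f-inj =
    map f xs , Unique-map⁺-on f (All.tabulate (from (∈xs _))) f-inj uxs , trans (length-map f xs) len ,
    λ y → mk⇔ into out
    where
    into : ∀ {y} → ∃[ x ] P x × f x ≡ y → y ∈ map f xs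
    into (x , Px , refl) = ∈-map⁺ f (to (∈xs x) Px)
    out : ∀ {y} → y ∈ map f xs → ∃[ x ] P x × f x ≡ y
    out y∈ with ∈-map⁻ f y∈
    ... | x , x∈xs , refl = x , from (∈xs x) x∈xs , refl

  IsCount-⊎ : IsCount P a → IsCount Q b → (∀ {x} → P x → Q x → ⊥) → IsCount (λ x → P x ⊎ Q x) (a + b)
  IsCount-⊎ {P = P} {Q = Q} (xs , uxs , lenx , ∈xs) (ys , uys , leny , ∈ys) disjoint =
    xs ++ ys ,
    Unique.++⁺ uxs uys (λ (x∈xs , x∈ys) → disjoint (from (∈xs _) x∈xs) (from (∈ys _) x∈ys)) ,
    trans (length-++ xs) (cong₂ _+_ lenx leny) ,
    λ x → mk⇔ into (out ∘ ∈-++⁻ xs)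
    where
    into : ∀ {x} → P x ⊎ Q x → x ∈ xs ++ ys
    into (inj₁ Px) = ∈-++⁺ˡ (to (∈xs _) Px)
    into (inj₂ Qx) = ∈-++⁺ʳ xs (to (∈ys _) Qx)
    out : ∀ {x} → x ∈ xs ⊎ x ∈ ys → P x ⊎ Q x
    out (inj₁ x∈xs) = inj₁ (from (∈xs _) x∈xs)
    out (inj₂ x∈ys) = inj₂ (from (∈ys _) x∈ys)

  IsCount-∃ : ∀ {s} {R : Fin s → A → Set} {c : Fin s → ℕ} → (∀ k → IsCount (R k) (c k)) →
              (∀ {k l x} → R k x → R l x → k ≡ l) → IsCount (λ x → ∃[ k ] R k x) (sum c)
  IsCount-∃ {s = zero} count disjoint = [] , [] , refl , λ x → mk⇔ (λ ()) (λ ())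
  IsCount-∃ {s = suc s} {R = R} count disjoint =
    IsCount-resp split (IsCount-⊎ (count zero) (IsCount-∃ (count ∘ suc) (λ Rk Rl → suc-injective (disjoint Rk Rl)))
                                   (λ R₀x (k , Rsk) → 0≢1+n (disjoint R₀x Rsk)))
    where
    split : ∀ x → (R zero x ⊎ ∃[ k ] R (suc k) x) ⇔ (∃[ k ] R k x)
    split x = mk⇔ [ (zero ,_) , (λ (k , Rsk) → suc k , Rsk) ]
                  (λ { (zero , R₀x) → inj₁ R₀x ; (suc k , Rsk) → inj₂ (k , Rsk) })

  IsCount-∁ : DecidableEquality A → ∀ {R : A → Set} {N} → IsCount (λ _ → ⊤) N → IsCount R a → IsCount (∁ R) (N ∸ a)
  IsCount-∁ {a = a} _≟_ {R} {N} countAll@(xs , uxs , _ , ∈xs) countR@(ys , _ , _ , ∈ys) =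
    subst (IsCount (∁ R)) (trans (sym (m+n∸n≡m _ a)) (cong (_∸ a) (trans (+-comm _ a) total))) count∁
    where
    open import Data.List.Membership.DecPropositional _≟_ using (_∈?_)
    ∉ys? = ¬? ∘ (_∈? ys)
    count∁ : IsCount (∁ R) (length (filter ∉ys? xs))
    count∁ = filter ∉ys? xs , Unique.filter⁺ ∉ys? uxs , refl ,
      λ x → mk⇔ (λ ¬Rx → ∈-filter⁺ ∉ys? (to (∈xs x) tt) (¬Rx ∘ from (∈ys x)))
                (λ x∈ → proj₂ (∈-filter⁻ ∉ys? {xs = xs} x∈) ∘ to (∈ys x))
    R? : ∀ x → Dec (R x)
    R? x = Dec.map′ (from (∈ys x)) (to (∈ys x)) (x ∈? ys)
    total : a + length (filter ∉ys? xs) ≡ N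
    total = IsCount-unique
      (IsCount-resp (λ x → mk⇔ (λ _ → tt) (λ _ → Dec.toSum (R? x))) (IsCount-⊎ countR count∁ (λ Rx ¬Rx → ¬Rx Rx)))
      countAll

  length-cartesianProduct : (xs : List A) (ys : List B) → length (cartesianProduct xs ys) ≡ length xs * length ys
  length-cartesianProduct []       ys = refl
  length-cartesianProduct (x ∷ xs) ys =
    trans (length-++ (map (x ,_) ys)) (cong₂ _+_ (length-map (x ,_) ys) (length-cartesianProduct xs ys))

  IsCount-× : IsCount P a → IsCount Q b → IsCount (λ (x , y) → P x × Q y) (a * b)
  IsCount-× (xs , uxs , lenx , ∈xs) (ys , uys , leny , ∈ys) =
    cartesianProduct xs ys , Unique.cartesianProduct⁺ uxs uys ,
    trans (length-cartesianProduct xs ys) (cong₂ _*_ lenx leny) ,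
    λ (x , y) → mk⇔ (λ (Px , Qy) → ∈-cartesianProduct⁺ (to (∈xs x) Px) (to (∈ys y) Qy))
                    (λ xy∈ → let x∈ , y∈ = ∈-cartesianProduct⁻ xs ys xy∈ in from (∈xs x) x∈ , from (∈ys y) y∈)

  IsCount-Fin : ∀ n → IsCount {Fin n} (λ _ → ⊤) n
  IsCount-Fin n = allFin n , Unique.allFin⁺ n , length-tabulate _ , λ i → mk⇔ (λ _ → ∈-allFin i) (λ _ → tt)

  IsCount-Vec : IsCount {A} (λ _ → ⊤) a → ∀ k → IsCount {Vec A k} (λ _ → ⊤) (a ^ k)
  IsCount-Vec countA zero = Vec.[] ∷ [] , [] ∷ [] , refl , λ { Vec.[] → mk⇔ (λ _ → here refl) (λ _ → tt) }
  IsCount-Vec countA (suc k) =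
    IsCount-resp (λ { (x Vec.∷ xs) → mk⇔ (λ _ → tt) (λ _ → (x , xs) , (tt , tt) , refl) })
      (IsCount-image (λ (x , xs) → x Vec.∷ xs) (IsCount-× countA (IsCount-Vec countA k))
        λ _ _ → uncurry (cong₂ _,_) ∘ ∷-injective)

module CoprimeCount where

  open import Data.Nat using (zero; suc; _+_; _*_; _∸_; _^_; _≤_; _<_; NonZero; >-nonZero⁻¹)
  open import Data.Nat.Properties
    using (+-*-semiring; +-comm; *-suc; *-zeroʳ; *-identityˡ; *-assoc; +-monoˡ-≤; ^-monoʳ-≤; m∸n+n≡m; module ≤-Reasoning)
  open import Data.Fin using (toℕ)
  open import Algebra.Properties.Semiring.Sum +-*-semiring using (sum-syntax; *-distribˡ-sum; sum-cong-≋)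
  open import Relation.Binary.PropositionalEquality

  -- c(j) = μ_q(n,1,j;(1)), the number of coprime columns of degree j
  coprimeCount : (q n : ℕ) → ℕ → ℕ
  coprimeCount q n zero    = 1
  coprimeCount q n (suc j) = q ^ (n * suc j) ∸ q ^ (n * j + 1)

  module _ (q n : ℕ) .{{_ : NonZero q}} .{{_ : NonZero n}} where

    private f = coprimeCount q n

    -- hence the subtraction in coprimeCount never truncates
    ^-n*m+1≤^-n*[1+m] : ∀ m → q ^ (n * m + 1) ≤ q ^ (n * suc m)
    ^-n*m+1≤^-n*[1+m] m = ^-monoʳ-≤ q (begin
      n * m + 1 ≡⟨ +-comm (n * m) 1 ⟩
      1 + n * m ≤⟨ +-monoˡ-≤ (n * m) (>-nonZero⁻¹ n) ⟩
      n + n * m ≡⟨ *-suc n m ⟨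
      n * suc m ∎)
      where open ≤-Reasoning

    mutual
      coprimeCount-convolution : ∀ m → ∑[ k < suc m ] (q ^ toℕ k * f (m ∸ toℕ k)) ≡ q ^ (n * m)
      coprimeCount-convolution zero = cong (q ^_) (sym (*-zeroʳ n))
      coprimeCount-convolution (suc m) = begin
        1 * f (suc m) + ∑[ k < suc m ] (q ^ suc (toℕ k) * f (m ∸ toℕ k))
          ≡⟨ cong₂ _+_ (*-identityˡ _) (shifted-convolution m) ⟩
        f (suc m) + q ^ (n * m + 1)
          ≡⟨ m∸n+n≡m (^-n*m+1≤^-n*[1+m] m) ⟩
        q ^ (n * suc m) ∎
        where open ≡-Reasoning

      shifted-convolution : ∀ m → ∑[ k < suc m ] (q ^ suc (toℕ k) * f (m ∸ toℕ k)) ≡ q ^ (n * m + 1)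
      shifted-convolution m = begin
        ∑[ k < suc m ] (q ^ suc (toℕ k) * f (m ∸ toℕ k))
          ≡⟨ sum-cong-≋ {suc m} (λ k → *-assoc q (q ^ toℕ k) (f (m ∸ toℕ k))) ⟩
        ∑[ k < suc m ] (q * (q ^ toℕ k * f (m ∸ toℕ k)))
          ≡⟨ *-distribˡ-sum {suc m} q (λ k → q ^ toℕ k * f (m ∸ toℕ k)) ⟨
        q * ∑[ k < suc m ] (q ^ toℕ k * f (m ∸ toℕ k))
          ≡⟨ cong (q *_) (coprimeCount-convolution m) ⟩
        q * q ^ (n * m)
          ≡⟨ cong (q ^_) (+-comm (n * m) 1) ⟨
        q ^ (n * m + 1) ∎
        where open ≡-Reasoning

  coprimeCount-nonzero : ∀ q n {j} → 0 < j → coprimeCount q n j ≡ q ^ (n * j) ∸ q ^ (n * (j ∸ 1) + 1)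
  coprimeCount-nonzero q n {suc j} _ = refl

module PolynomialRing {q : ℕ} (F : FiniteField q) where

  open import Level using (0ℓ)
  open import Data.Nat using (zero; suc)
  open import Data.List using ([]; _∷_)
  open import Data.Product using (_,_)
  open import Function.Base using (_∘_)
  open import Relation.Binary.Bundles using (Setoid)
  open import Relation.Binary.Structures using (IsEquivalence)
  open import Relation.Binary.PropositionalEquality as ≡ using (_≡_; cong; cong₂)
  open import Algebra.Bundles using (CommutativeRing; CommutativeMonoid)
  open import Algebra.Structures using (IsCommutativeMonoid)

  open FiniteField F using (isCommutativeRing)
  open PolyOver F using (Poly; coeff; _+ₚ_; scale; _*ₚ_)

  coefficientRing : CommutativeRing 0ℓ 0ℓ
  coefficientRing = record { isCommutativeRing = isCommutativeRing }

  open import Algebra.Properties.Ring (CommutativeRing.ring coefficientRing) using (-1*x≈-x)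
  open CommutativeRing coefficientRing public
    using (_+_; _*_; -_; 0#; 1#; +-assoc; +-comm; +-identityˡ; +-identityʳ; -‿inverseˡ; -‿inverseʳ;
           *-assoc; *-comm; *-identityˡ; *-identityʳ; distribˡ; distribʳ; zeroˡ; zeroʳ)

  -- Defs' _≈ₚ_, as a record so that both polynomials can be inferred from an equation
  infix 4 _≋_
  record _≋_ (p r : Poly) : Set where
    constructor coeffwise
    field coeff-≡ : ∀ i → coeff p i ≡ coeff r i
  open _≋_ public

  ≋-isEquivalence : IsEquivalence _≋_
  ≋-isEquivalence = record
    { refl  = coeffwise λ _ → ≡.refl
    ; sym   = λ p≋r → coeffwise λ i → ≡.sym (coeff-≡ p≋r i)
    ; trans = λ p≋r r≋s → coeffwise λ i → ≡.trans (coeff-≡ p≋r i) (coeff-≡ r≋s i)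
    }

  ≋-setoid : Setoid 0ℓ 0ℓ
  ≋-setoid = record { isEquivalence = ≋-isEquivalence }

  open IsEquivalence ≋-isEquivalence public using () renaming (refl to ≋-refl; sym to ≋-sym; trans to ≋-trans)

  0ₚ 1ₚ : Poly
  0ₚ = []
  1ₚ = 1# ∷ []

  -ₚ_ : Poly → Poly
  -ₚ p = scale (- 1#) p

  coeff-+ₚ : ∀ p r i → coeff (p +ₚ r) i ≡ coeff p i + coeff r i
  coeff-+ₚ []      r       i       = ≡.sym (+-identityˡ _)
  coeff-+ₚ (a ∷ p) []      zero    = ≡.sym (+-identityʳ _)
  coeff-+ₚ (a ∷ p) []      (suc i) = ≡.sym (+-identityʳ _)
  coeff-+ₚ (a ∷ p) (b ∷ r) zero    = ≡.refl
  coeff-+ₚ (a ∷ p) (b ∷ r) (suc i) = coeff-+ₚ p r i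

  coeff-scale : ∀ a p i → coeff (scale a p) i ≡ a * coeff p i
  coeff-scale a []      i       = ≡.sym (zeroʳ a)
  coeff-scale a (b ∷ p) zero    = ≡.refl
  coeff-scale a (b ∷ p) (suc i) = coeff-scale a p i

  +ₚ-cong : ∀ {p p' r r'} → p ≋ p' → r ≋ r' → p +ₚ r ≋ p' +ₚ r'
  +ₚ-cong {p} {p'} {r} {r'} p≋p' r≋r' = coeffwise λ i → begin
    coeff (p +ₚ r) i        ≡⟨ coeff-+ₚ p r i ⟩
    coeff p i + coeff r i   ≡⟨ cong₂ _+_ (coeff-≡ p≋p' i) (coeff-≡ r≋r' i) ⟩
    coeff p' i + coeff r' i ≡⟨ coeff-+ₚ p' r' i ⟨
    coeff (p' +ₚ r') i      ∎
    where open ≡.≡-Reasoning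

  +ₚ-assoc : ∀ p r s → (p +ₚ r) +ₚ s ≋ p +ₚ (r +ₚ s)
  +ₚ-assoc p r s = coeffwise λ i → begin
    coeff ((p +ₚ r) +ₚ s) i               ≡⟨ coeff-+ₚ (p +ₚ r) s i ⟩
    coeff (p +ₚ r) i + coeff s i          ≡⟨ cong (_+ coeff s i) (coeff-+ₚ p r i) ⟩
    coeff p i + coeff r i + coeff s i     ≡⟨ +-assoc _ _ _ ⟩
    coeff p i + (coeff r i + coeff s i)   ≡⟨ cong (coeff p i +_) (coeff-+ₚ r s i) ⟨
    coeff p i + coeff (r +ₚ s) i          ≡⟨ coeff-+ₚ p (r +ₚ s) i ⟨
    coeff (p +ₚ (r +ₚ s)) i               ∎
    where open ≡.≡-Reasoning

  +ₚ-comm : ∀ p r → p +ₚ r ≋ r +ₚ p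
  +ₚ-comm p r = coeffwise λ i → ≡.trans (coeff-+ₚ p r i) (≡.trans (+-comm _ _) (≡.sym (coeff-+ₚ r p i)))

  +ₚ-identityʳ : ∀ p → p +ₚ 0ₚ ≋ p
  +ₚ-identityʳ p = coeffwise λ i → ≡.trans (coeff-+ₚ p [] i) (+-identityʳ _)

  coeff--ₚ : ∀ p i → coeff (-ₚ p) i ≡ - coeff p i
  coeff--ₚ p i = ≡.trans (coeff-scale (- 1#) p i) (-1*x≈-x (coeff p i))

  -ₚ‿inverseʳ : ∀ p → p +ₚ (-ₚ p) ≋ 0ₚ
  -ₚ‿inverseʳ p = coeffwise λ i →
    ≡.trans (coeff-+ₚ p (-ₚ p) i) (≡.trans (cong (coeff p i +_) (coeff--ₚ p i)) (-‿inverseʳ _))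

  scale-cong : ∀ a {p p'} → p ≋ p' → scale a p ≋ scale a p'
  scale-cong a {p} {p'} p≋p' = coeffwise λ i →
    ≡.trans (coeff-scale a p i) (≡.trans (cong (a *_) (coeff-≡ p≋p' i)) (≡.sym (coeff-scale a p' i)))

  scale-distrib-+ₚ : ∀ a p r → scale a (p +ₚ r) ≋ scale a p +ₚ scale a r
  scale-distrib-+ₚ a p r = coeffwise λ i → begin
    coeff (scale a (p +ₚ r)) i                  ≡⟨ coeff-scale a (p +ₚ r) i ⟩
    a * coeff (p +ₚ r) i                        ≡⟨ cong (a *_) (coeff-+ₚ p r i) ⟩
    a * (coeff p i + coeff r i)                 ≡⟨ distribˡ _ _ _ ⟩
    a * coeff p i + a * coeff r i               ≡⟨ cong₂ _+_ (coeff-scale a p i) (coeff-scale a r i) ⟨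
    coeff (scale a p) i + coeff (scale a r) i   ≡⟨ coeff-+ₚ (scale a p) (scale a r) i ⟨
    coeff (scale a p +ₚ scale a r) i            ∎
    where open ≡.≡-Reasoning

  scale-distrib-+ : ∀ a b p → scale (a + b) p ≋ scale a p +ₚ scale b p
  scale-distrib-+ a b p = coeffwise λ i → begin
    coeff (scale (a + b) p) i                   ≡⟨ coeff-scale (a + b) p i ⟩
    (a + b) * coeff p i                         ≡⟨ distribʳ _ _ _ ⟩
    a * coeff p i + b * coeff p i               ≡⟨ cong₂ _+_ (coeff-scale a p i) (coeff-scale b p i) ⟨
    coeff (scale a p) i + coeff (scale b p) i   ≡⟨ coeff-+ₚ (scale a p) (scale b p) i ⟨
    coeff (scale a p +ₚ scale b p) i            ∎
    where open ≡.≡-Reasoning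

  scale-assoc : ∀ a b p → scale a (scale b p) ≋ scale (a * b) p
  scale-assoc a b p = coeffwise λ i →
    ≡.trans (coeff-scale a (scale b p) i)
      (≡.trans (cong (a *_) (coeff-scale b p i)) (≡.trans (≡.sym (*-assoc _ _ _)) (≡.sym (coeff-scale (a * b) p i))))

  scale-identity : ∀ p → scale 1# p ≋ p
  scale-identity p = coeffwise λ i → ≡.trans (coeff-scale 1# p i) (*-identityˡ _)

  scale-zero : ∀ p → scale 0# p ≋ 0ₚ
  scale-zero p = coeffwise λ i → ≡.trans (coeff-scale 0# p i) (zeroˡ _)

  ∷-cong : ∀ {a b p p'} → a ≡ b → p ≋ p' → a ∷ p ≋ b ∷ p'
  ∷-cong a≡b p≋p' = coeffwise λ { zero → a≡b ; (suc i) → coeff-≡ p≋p' i }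

  tail-≋ : ∀ {a b p p'} → a ∷ p ≋ b ∷ p' → p ≋ p'
  tail-≋ a∷p≋b∷p' = coeffwise λ i → coeff-≡ a∷p≋b∷p' (suc i)

  ∷-≋0ₚ : ∀ {a p} → a ≡ 0# → p ≋ 0ₚ → a ∷ p ≋ 0ₚ
  ∷-≋0ₚ a≡0 p≋0 = coeffwise λ { zero → a≡0 ; (suc i) → coeff-≡ p≋0 i }

  +ₚ-isCommutativeMonoid : IsCommutativeMonoid _≋_ _+ₚ_ 0ₚ
  +ₚ-isCommutativeMonoid = record
    { isMonoid = record
      { isSemigroup = record
        { isMagma = record { isEquivalence = ≋-isEquivalence ; ∙-cong = +ₚ-cong }
        ; assoc   = +ₚ-assoc }
      ; identity = (λ _ → ≋-refl) , +ₚ-identityʳ }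
    ; comm = +ₚ-comm }

  +ₚ-commutativeMonoid : CommutativeMonoid 0ℓ 0ℓ
  +ₚ-commutativeMonoid = record { isCommutativeMonoid = +ₚ-isCommutativeMonoid }

  open import Algebra.Properties.CommutativeSemigroup (CommutativeMonoid.commutativeSemigroup +ₚ-commutativeMonoid)
    using () renaming (interchange to +ₚ-interchange; x∙yz≈y∙xz to +ₚ-left-commute)

  open import Relation.Binary.Reasoning.Setoid ≋-setoid

  ≡⇒≋ : ∀ {p r} → p ≡ r → p ≋ r
  ≡⇒≋ ≡.refl = ≋-refl

  *ₚ-zeroˡ-≋ : ∀ {p} r → p ≋ 0ₚ → p *ₚ r ≋ 0ₚ
  *ₚ-zeroˡ-≋ {[]}    r _   = ≋-refl
  *ₚ-zeroˡ-≋ {a ∷ p} r p≋0 = begin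
    scale a r +ₚ (0# ∷ (p *ₚ r))  ≈⟨ +ₚ-cong (≡⇒≋ (cong (λ x → scale x r) (coeff-≡ p≋0 zero))) ≋-refl ⟩
    scale 0# r +ₚ (0# ∷ (p *ₚ r)) ≈⟨ +ₚ-cong (scale-zero r) (∷-≋0ₚ ≡.refl (*ₚ-zeroˡ-≋ {p} r p≋0ₚ)) ⟩
    0ₚ +ₚ 0ₚ                      ∎
    where
    p≋0ₚ : p ≋ 0ₚ
    p≋0ₚ = coeffwise (coeff-≡ p≋0 ∘ suc)

  *ₚ-congʳ : ∀ r {p p'} → p ≋ p' → p *ₚ r ≋ p' *ₚ r
  *ₚ-congʳ r {[]}    {p'}     p≋p' = ≋-sym (*ₚ-zeroˡ-≋ r (≋-sym p≋p'))
  *ₚ-congʳ r {a ∷ p} {[]}     p≋p' = *ₚ-zeroˡ-≋ r p≋p'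
  *ₚ-congʳ r {a ∷ p} {b ∷ p'} p≋p' =
    +ₚ-cong (≡⇒≋ (cong (λ x → scale x r) (coeff-≡ p≋p' zero))) (∷-cong ≡.refl (*ₚ-congʳ r (tail-≋ p≋p')))

  *ₚ-congˡ : ∀ p {r r'} → r ≋ r' → p *ₚ r ≋ p *ₚ r'
  *ₚ-congˡ []      r≋r' = ≋-refl
  *ₚ-congˡ (a ∷ p) r≋r' = +ₚ-cong (scale-cong a r≋r') (∷-cong ≡.refl (*ₚ-congˡ p r≋r'))

  0∷-*ₚ : ∀ p r → (0# ∷ p) *ₚ r ≋ 0# ∷ (p *ₚ r)
  0∷-*ₚ p r = +ₚ-cong (scale-zero r) ≋-refl

  *ₚ-distribʳ : ∀ r p p' → (p +ₚ p') *ₚ r ≋ (p *ₚ r) +ₚ (p' *ₚ r)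
  *ₚ-distribʳ r []      p'       = ≋-refl
  *ₚ-distribʳ r (a ∷ p) []       = ≋-sym (+ₚ-identityʳ _)
  *ₚ-distribʳ r (a ∷ p) (b ∷ p') = begin
    scale (a + b) r +ₚ (0# ∷ ((p +ₚ p') *ₚ r))
      ≈⟨ +ₚ-cong (scale-distrib-+ a b r) (∷-cong (≡.sym (+-identityˡ 0#)) (*ₚ-distribʳ r p p')) ⟩
    (scale a r +ₚ scale b r) +ₚ ((0# ∷ (p *ₚ r)) +ₚ (0# ∷ (p' *ₚ r)))
      ≈⟨ +ₚ-interchange (scale a r) (scale b r) (0# ∷ (p *ₚ r)) (0# ∷ (p' *ₚ r)) ⟩
    (scale a r +ₚ (0# ∷ (p *ₚ r))) +ₚ (scale b r +ₚ (0# ∷ (p' *ₚ r))) ∎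

  scale-*ₚ : ∀ a p r → scale a (p *ₚ r) ≋ scale a p *ₚ r
  scale-*ₚ a []      r = ≋-refl
  scale-*ₚ a (b ∷ p) r = begin
    scale a (scale b r +ₚ (0# ∷ (p *ₚ r)))              ≈⟨ scale-distrib-+ₚ a (scale b r) _ ⟩
    scale a (scale b r) +ₚ ((a * 0#) ∷ scale a (p *ₚ r)) ≈⟨ +ₚ-cong (scale-assoc a b r) (∷-cong (zeroʳ a) (scale-*ₚ a p r)) ⟩
    scale (a * b) r +ₚ (0# ∷ (scale a p *ₚ r))           ∎

  *ₚ-assoc : ∀ p r s → (p *ₚ r) *ₚ s ≋ p *ₚ (r *ₚ s)
  *ₚ-assoc []      r s = ≋-refl
  *ₚ-assoc (a ∷ p) r s = begin
    (scale a r +ₚ (0# ∷ (p *ₚ r))) *ₚ s          ≈⟨ *ₚ-distribʳ s (scale a r) _ ⟩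
    (scale a r *ₚ s) +ₚ ((0# ∷ (p *ₚ r)) *ₚ s)   ≈⟨ +ₚ-cong (≋-sym (scale-*ₚ a r s)) (0∷-*ₚ (p *ₚ r) s) ⟩
    scale a (r *ₚ s) +ₚ (0# ∷ ((p *ₚ r) *ₚ s))   ≈⟨ +ₚ-cong ≋-refl (∷-cong ≡.refl (*ₚ-assoc p r s)) ⟩
    scale a (r *ₚ s) +ₚ (0# ∷ (p *ₚ (r *ₚ s)))   ∎

  *ₚ-identityˡ : ∀ p → 1ₚ *ₚ p ≋ p
  *ₚ-identityˡ p = ≋-trans (+ₚ-cong (scale-identity p) (∷-≋0ₚ ≡.refl ≋-refl)) (+ₚ-identityʳ p)

  *ₚ-zeroʳ : ∀ p → p *ₚ 0ₚ ≋ 0ₚ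
  *ₚ-zeroʳ []      = ≋-refl
  *ₚ-zeroʳ (a ∷ p) = ∷-≋0ₚ ≡.refl (*ₚ-zeroʳ p)

  *ₚ-∷ : ∀ r a p → r *ₚ (a ∷ p) ≋ scale a r +ₚ (0# ∷ (r *ₚ p))
  *ₚ-∷ []      a p = ≋-sym (∷-≋0ₚ ≡.refl ≋-refl)
  *ₚ-∷ (c ∷ r) a p = ∷-cong (cong (_+ 0#) (*-comm c a)) (begin
    scale c p +ₚ (r *ₚ (a ∷ p))                  ≈⟨ +ₚ-cong ≋-refl (*ₚ-∷ r a p) ⟩
    scale c p +ₚ (scale a r +ₚ (0# ∷ (r *ₚ p)))  ≈⟨ +ₚ-left-commute (scale c p) (scale a r) (0# ∷ (r *ₚ p)) ⟩
    scale a r +ₚ (scale c p +ₚ (0# ∷ (r *ₚ p)))  ∎)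

  *ₚ-comm : ∀ p r → p *ₚ r ≋ r *ₚ p
  *ₚ-comm []      r = ≋-sym (*ₚ-zeroʳ r)
  *ₚ-comm (a ∷ p) r = ≋-trans (+ₚ-cong ≋-refl (∷-cong ≡.refl (*ₚ-comm p r))) (≋-sym (*ₚ-∷ r a p))

  *ₚ-identityʳ : ∀ p → p *ₚ 1ₚ ≋ p
  *ₚ-identityʳ p = ≋-trans (*ₚ-comm p 1ₚ) (*ₚ-identityˡ p)

  *ₚ-distribˡ : ∀ p r s → p *ₚ (r +ₚ s) ≋ (p *ₚ r) +ₚ (p *ₚ s)
  *ₚ-distribˡ p r s = ≋-trans (*ₚ-comm p _) (≋-trans (*ₚ-distribʳ p r s) (+ₚ-cong (*ₚ-comm r p) (*ₚ-comm s p)))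

  polynomialRing : CommutativeRing 0ℓ 0ℓ
  polynomialRing = record
    { isCommutativeRing = record
      { isRing = record
        { +-isAbelianGroup = record
          { isGroup = record
            { isMonoid = IsCommutativeMonoid.isMonoid +ₚ-isCommutativeMonoid
            ; inverse  = (λ p → ≋-trans (+ₚ-comm _ p) (-ₚ‿inverseʳ p)) , -ₚ‿inverseʳ
            ; ⁻¹-cong  = scale-cong (- 1#) }
          ; comm = +ₚ-comm }
        ; *-cong     = λ {p} {p'} {r} {r'} p≋p' r≋r' → ≋-trans (*ₚ-congʳ r p≋p') (*ₚ-congˡ p' r≋r')
        ; *-assoc    = *ₚ-assoc
        ; *-identity = *ₚ-identityˡ , *ₚ-identityʳ
        ; distrib    = *ₚ-distribˡ , *ₚ-distribʳ }
      ; *-comm = *ₚ-comm } }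

  open import Algebra.Properties.Semiring.Divisibility (CommutativeRing.semiring polynomialRing) public
    using (_∣ˡ_; _,_; ∣ˡ-respʳ-≈; ∣ˡ-respˡ-≈; x∣ˡxy; x∣ˡy⇒x∣ˡyz; x∣ˡy⇒zx∣ˡzy)

  1ₚ∣ˡ : ∀ p → 1ₚ ∣ˡ p
  1ₚ∣ˡ p = p , *ₚ-identityˡ p

module PolynomialDegree {q : ℕ} (F : FiniteField q) where

  open import Function.Base using (_∘_)
  open import Algebra.Bundles using (CommutativeRing)
  open import Data.Nat as ℕ using (zero; suc; _≤_; _<_; z≤n; s≤s; _≤?_)
  import Data.Nat.Properties as ℕₚ
  open import Data.Fin using () renaming (_≟_ to _≟ᶠ_)
  open import Data.List using ([]; _∷_)
  open import Data.Product using (∃-syntax; _×_; _,_)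
  open import Data.Sum using (_⊎_; inj₁; inj₂)
  open import Data.Empty using (⊥-elim)
  open import Relation.Nullary using (¬_; yes; no)
  open import Relation.Binary.PropositionalEquality as ≡ using (_≡_; _≢_; cong; cong₂; subst)

  open FiniteField F using (_⁻¹; inverseʳ; 0≢1)
  open PolyOver F using (Poly; coeff; _+ₚ_; scale; _*ₚ_)
  open PolynomialRing F
  open import Algebra.Properties.Ring (CommutativeRing.ring polynomialRing)
    using (x[y-z]≈xy-xz; x∙y⁻¹≈ε⇒x≈y; x≈y⇒x∙y⁻¹≈ε; \\-leftDividesˡ)
  open import Algebra.Properties.CommutativeSemigroup (CommutativeRing.+-commutativeSemigroup polynomialRing)
    using (x∙yz≈yx∙z)

  record Deg< (k : ℕ) (p : Poly) : Set where
    constructor deg<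
    field vanishes : ∀ i → k ≤ i → coeff p i ≡ 0#
  open Deg< public

  record Monic (k : ℕ) (p : Poly) : Set where
    field
      deg<1+    : Deg< (suc k) p
      leading≡1 : coeff p k ≡ 1#
  open Monic public

  record HasDegree (t : ℕ) (p : Poly) : Set where
    field
      deg<1+    : Deg< (suc t) p
      leading≢0 : coeff p t ≢ 0#
  open HasDegree public

  Deg<-mono : ∀ {k k' p} → k ≤ k' → Deg< k p → Deg< k' p
  Deg<-mono k≤k' p<k = deg< λ i k'≤i → vanishes p<k i (ℕₚ.≤-trans k≤k' k'≤i)

  Deg<-resp : ∀ {k p p'} → p ≋ p' → Deg< k p → Deg< k p'
  Deg<-resp p≋p' p<k = deg< λ i k≤i → ≡.trans (≡.sym (coeff-≡ p≋p' i)) (vanishes p<k i k≤i)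

  HasDegree-resp : ∀ {t p p'} → p ≋ p' → HasDegree t p → HasDegree t p'
  HasDegree-resp p≋p' p°t = record
    { deg<1+ = Deg<-resp p≋p' (deg<1+ p°t) ; leading≢0 = leading≢0 p°t ∘ ≡.trans (coeff-≡ p≋p' _) }

  Deg<-zero : ∀ {p} → Deg< 0 p → p ≋ 0ₚ
  Deg<-zero p<0 = coeffwise λ i → vanishes p<0 i z≤n

  Deg<-∷ : ∀ {a k p} → Deg< (suc k) (a ∷ p) → Deg< k p
  Deg<-∷ ap<1+k = deg< λ i k≤i → vanishes ap<1+k (suc i) (s≤s k≤i)

  ∷-Deg< : ∀ {a k p} → Deg< k p → Deg< (suc k) (a ∷ p)
  ∷-Deg< p<k = deg< λ { (suc i) (s≤s k≤i) → vanishes p<k i k≤i }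

  degree<bound : ∀ {t k p} → HasDegree t p → Deg< k p → t < k
  degree<bound {t} {k} p°t p<k with suc t ≤? k
  ... | yes t<k = t<k
  ... | no  t≮k = ⊥-elim (leading≢0 p°t (vanishes p<k t (ℕₚ.≮⇒≥ t≮k)))

  Monic-nonzero : ∀ {k p} → Monic k p → ¬ p ≋ 0ₚ
  Monic-nonzero mp p≋0 = 0≢1 (≡.trans (≡.sym (coeff-≡ p≋0 _)) (leading≡1 mp))

  ≋0ₚ⊎HasDegree : ∀ p → p ≋ 0ₚ ⊎ ∃[ t ] HasDegree t p
  ≋0ₚ⊎HasDegree [] = inj₁ ≋-refl
  ≋0ₚ⊎HasDegree (a ∷ p) with ≋0ₚ⊎HasDegree p
  ... | inj₂ (t , p°t) = inj₂ (suc t , record { deg<1+ = ∷-Deg< (deg<1+ p°t) ; leading≢0 = leading≢0 p°t })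
  ... | inj₁ p≋0 with a ≟ᶠ 0#
  ...   | yes a≡0 = inj₁ (∷-≋0ₚ a≡0 p≋0)
  ...   | no  a≢0 = inj₂ (0 , record { deg<1+ = ∷-Deg< (deg< λ i _ → coeff-≡ p≋0 i) ; leading≢0 = a≢0 })

  Deg<-+ₚ : ∀ {k p r} → Deg< k p → Deg< k r → Deg< k (p +ₚ r)
  Deg<-+ₚ {p = p} {r} p<k r<k = deg< λ i k≤i →
    ≡.trans (coeff-+ₚ p r i) (≡.trans (cong₂ _+_ (vanishes p<k i k≤i) (vanishes r<k i k≤i)) (+-identityˡ 0#))

  Deg<-scale : ∀ {k p} c → Deg< k p → Deg< k (scale c p)
  Deg<-scale {p = p} c p<k = deg< λ i k≤i →
    ≡.trans (coeff-scale c p i) (≡.trans (cong (c *_) (vanishes p<k i k≤i)) (zeroʳ c))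

  constant-*ₚ : ∀ {c p} r → p ≋ 0ₚ → (c ∷ p) *ₚ r ≋ scale c r
  constant-*ₚ {c} {p} r p≋0 = ≋-trans (+ₚ-cong ≋-refl (∷-≋0ₚ ≡.refl (*ₚ-zeroˡ-≋ r p≋0))) (+ₚ-identityʳ (scale c r))

  coeff-∷-*ₚ : ∀ c p r i → coeff ((c ∷ p) *ₚ r) (suc i) ≡ c * coeff r (suc i) + coeff (p *ₚ r) i
  coeff-∷-*ₚ c p r i = ≡.trans (coeff-+ₚ (scale c r) (0# ∷ (p *ₚ r)) (suc i)) (cong (_+ _) (coeff-scale c r (suc i)))

  *ₚ-Deg< : ∀ {a b p r} → Deg< (suc a) p → Deg< b r → Deg< (a ℕ.+ b) (p *ₚ r)
  *ₚ-Deg< {p = []} _ _ = deg< λ _ _ → ≡.refl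
  *ₚ-Deg< {zero} {p = c ∷ p} {r} cp<1 r<b = Deg<-resp (≋-sym (constant-*ₚ r (Deg<-zero (Deg<-∷ cp<1)))) (Deg<-scale c r<b)
  *ₚ-Deg< {suc a} {b} {c ∷ p} {r} cp<2+a r<b =
    Deg<-+ₚ (Deg<-mono (ℕₚ.m≤n+m b (suc a)) (Deg<-scale c r<b)) (∷-Deg< (*ₚ-Deg< (Deg<-∷ cp<2+a) r<b))

  coeff-*ₚ-top : ∀ {a b p r} → Deg< (suc a) p → Deg< (suc b) r → coeff (p *ₚ r) (a ℕ.+ b) ≡ coeff p a * coeff r b
  coeff-*ₚ-top {p = []} _ _ = ≡.sym (zeroˡ _)
  coeff-*ₚ-top {zero} {b} {c ∷ p} {r} cp<1 r<1+b =
    ≡.trans (coeff-≡ (constant-*ₚ r (Deg<-zero (Deg<-∷ cp<1))) b) (coeff-scale c r b)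
  coeff-*ₚ-top {suc a} {b} {c ∷ p} {r} cp<2+a r<1+b = begin
    coeff ((c ∷ p) *ₚ r) (suc (a ℕ.+ b))                   ≡⟨ coeff-∷-*ₚ c p r (a ℕ.+ b) ⟩
    c * coeff r (suc (a ℕ.+ b)) + coeff (p *ₚ r) (a ℕ.+ b)
      ≡⟨ cong₂ _+_ (cong (c *_) r-vanishes) (coeff-*ₚ-top (Deg<-∷ cp<2+a) r<1+b) ⟩
    c * 0# + coeff p a * coeff r b                         ≡⟨ cong (_+ coeff p a * coeff r b) (zeroʳ c) ⟩
    0# + coeff p a * coeff r b                             ≡⟨ +-identityˡ _ ⟩
    coeff p a * coeff r b                                  ∎
    where
    open ≡.≡-Reasoning
    r-vanishes = vanishes r<1+b (suc (a ℕ.+ b)) (s≤s (ℕₚ.m≤n+m b a))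

  Deg<-suc-+ : ∀ {k j p} → Deg< (k ℕ.+ suc j) p → Deg< (suc (k ℕ.+ j)) p
  Deg<-suc-+ {k} {j} {p} = subst (λ x → Deg< x p) (ℕₚ.+-suc k j)

  Monic-*ₚ-Monic : ∀ {k j h r} → Monic k h → Monic j r → Monic (k ℕ.+ j) (h *ₚ r)
  Monic-*ₚ-Monic {k} {j} {h} {r} mh mr = record
    { deg<1+    = Deg<-suc-+ (*ₚ-Deg< (deg<1+ mh) (deg<1+ mr))
    ; leading≡1 = ≡.trans (coeff-*ₚ-top (deg<1+ mh) (deg<1+ mr))
                          (≡.trans (cong₂ _*_ (leading≡1 mh) (leading≡1 mr)) (*-identityˡ 1#)) }

  Monic-*ₚ-HasDegree : ∀ {k t h r} → Monic k h → HasDegree t r → HasDegree (k ℕ.+ t) (h *ₚ r)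
  Monic-*ₚ-HasDegree {k} {t} {h} {r} mh r°t = record
    { deg<1+    = Deg<-suc-+ (*ₚ-Deg< (deg<1+ mh) (deg<1+ r°t))
    ; leading≢0 = λ hr≡0 → leading≢0 r°t (begin
        coeff r t                ≡⟨ *-identityˡ _ ⟨
        1# * coeff r t           ≡⟨ cong (_* coeff r t) (leading≡1 mh) ⟨
        coeff h k * coeff r t    ≡⟨ coeff-*ₚ-top (deg<1+ mh) (deg<1+ r°t) ⟨
        coeff (h *ₚ r) (k ℕ.+ t) ≡⟨ hr≡0 ⟩
        0#                       ∎) }
    where open ≡.≡-Reasoning

  Monic-*ₚ-≋0ₚ : ∀ {k h s} → Monic k h → h *ₚ s ≋ 0ₚ → s ≋ 0ₚ
  Monic-*ₚ-≋0ₚ {s = s} mh hs≋0 with ≋0ₚ⊎HasDegree s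
  ... | inj₁ s≋0       = s≋0
  ... | inj₂ (t , s°t) = ⊥-elim (leading≢0 (Monic-*ₚ-HasDegree mh s°t) (coeff-≡ hs≋0 _))

  Monic-*ₚ-cancelˡ : ∀ {k h s s'} → Monic k h → h *ₚ s ≋ h *ₚ s' → s ≋ s'
  Monic-*ₚ-cancelˡ {h = h} {s} {s'} mh hs≋hs' =
    x∙y⁻¹≈ε⇒x≈y s s' (Monic-*ₚ-≋0ₚ mh (≋-trans (x[y-z]≈xy-xz h s s') (x≈y⇒x∙y⁻¹≈ε hs≋hs')))

  quotient-Deg< : ∀ {k j h u p} → Monic k h → h *ₚ u ≋ p → Deg< (k ℕ.+ j) p → Deg< j u
  quotient-Deg< {k} {j} {u = u} mh hu≋p p<k+j with ≋0ₚ⊎HasDegree u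
  ... | inj₁ u≋0       = deg< λ i _ → coeff-≡ u≋0 i
  ... | inj₂ (t , u°t) = Deg<-mono (ℕₚ.+-cancelˡ-< k t j k+t<k+j) (deg<1+ u°t)
    where
    k+t<k+j : k ℕ.+ t < k ℕ.+ j
    k+t<k+j = degree<bound (Monic-*ₚ-HasDegree mh u°t) (Deg<-resp (≋-sym hu≋p) p<k+j)

  quotient-Monic : ∀ {k j h u p} → Monic k h → h *ₚ u ≋ p → Monic (k ℕ.+ j) p → Monic j u
  quotient-Monic {k} {j} {h} {u} {p} mh hu≋p mp = record
    { deg<1+    = u<1+j
    ; leading≡1 = begin
        coeff u j                ≡⟨ *-identityˡ _ ⟨
        1# * coeff u j           ≡⟨ cong (_* coeff u j) (leading≡1 mh) ⟨
        coeff h k * coeff u j    ≡⟨ coeff-*ₚ-top (deg<1+ mh) u<1+j ⟨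
        coeff (h *ₚ u) (k ℕ.+ j) ≡⟨ coeff-≡ hu≋p _ ⟩
        coeff p (k ℕ.+ j)        ≡⟨ leading≡1 mp ⟩
        1#                       ∎ }
    where
    open ≡.≡-Reasoning
    u<1+j : Deg< (suc j) u
    u<1+j = quotient-Deg< mh hu≋p (subst (λ x → Deg< x p) (≡.sym (ℕₚ.+-suc k j)) (deg<1+ mp))

  Monic-∣ˡ-≤ : ∀ {k m h p} → Monic k h → Monic m p → h ∣ˡ p → k ≤ m
  Monic-∣ˡ-≤ {k} {m} {h} mh mp (u , hu≋p) with ≋0ₚ⊎HasDegree u
  ... | inj₁ u≋0       = ⊥-elim (Monic-nonzero mp (≋-trans (≋-sym hu≋p) (≋-trans (*ₚ-congˡ h u≋0) (*ₚ-zeroʳ h))))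
  ... | inj₂ (t , u°t) =
    ℕₚ.m+n≤o⇒m≤o k (ℕₚ.≤-pred (degree<bound (HasDegree-resp hu≋p (Monic-*ₚ-HasDegree mh u°t)) (deg<1+ mp)))

  Monic-zero⇒≋1ₚ : ∀ {u} → Monic 0 u → u ≋ 1ₚ
  Monic-zero⇒≋1ₚ mu = coeffwise λ { zero → leading≡1 mu ; (suc i) → vanishes (deg<1+ mu) (suc i) (s≤s z≤n) }

  Monic-∣ˡ-antisym : ∀ {k k' g g'} → Monic k g → Monic k' g' → g ∣ˡ g' → g' ∣ˡ g → k ≡ k' × g ≋ g'
  Monic-∣ˡ-antisym {k} {k'} {g} {g'} mg mg' g∣g'@(u , gu≋g') g'∣g = k≡k' , (begin
    g         ≈⟨ *ₚ-identityʳ g ⟨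
    g *ₚ 1ₚ   ≈⟨ *ₚ-congˡ g (Monic-zero⇒≋1ₚ mu) ⟨
    g *ₚ u    ≈⟨ gu≋g' ⟩
    g'        ∎)
    where
    open import Relation.Binary.Reasoning.Setoid ≋-setoid
    k≡k' = ℕₚ.≤-antisym (Monic-∣ˡ-≤ mg mg' g∣g') (Monic-∣ˡ-≤ mg' mg g'∣g)
    mu : Monic 0 u
    mu = quotient-Monic mg gu≋g' (subst (λ x → Monic x g') (≡.trans (≡.sym k≡k') (≡.sym (ℕₚ.+-identityʳ k))) mg')

  normalise-Monic : ∀ {t p} → HasDegree t p → Monic t (scale (coeff p t ⁻¹) p)
  normalise-Monic {t} {p} p°t = record
    { deg<1+    = Deg<-scale _ (deg<1+ p°t)
    ; leading≡1 = ≡.trans (coeff-scale _ p t) (≡.trans (*-comm _ _) (inverseʳ _ (leading≢0 p°t))) }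

  record Division (t : ℕ) (a b : Poly) : Set where
    field
      quotient remainder : Poly
      a≋qb+r             : a ≋ (quotient *ₚ b) +ₚ remainder
      remainder<t        : Deg< t remainder

  cancel-top : ∀ {t b s} → Monic t b → Deg< (suc t) s → Deg< t ((-ₚ scale (coeff s t) b) +ₚ s)
  cancel-top {t} {b} {s} mb s<1+t = deg< λ i t≤i → begin
    coeff ((-ₚ scale c b) +ₚ s) i       ≡⟨ coeff-+ₚ (-ₚ scale c b) s i ⟩
    coeff (-ₚ scale c b) i + coeff s i  ≡⟨ cong (_+ coeff s i) (coeff--ₚ (scale c b) i) ⟩
    - coeff (scale c b) i + coeff s i   ≡⟨ cong (λ x → - x + coeff s i) (coeff-scale c b i) ⟩
    - (c * coeff b i) + coeff s i       ≡⟨ cancels i t≤i ⟩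
    0#                                  ∎
    where
    open ≡.≡-Reasoning
    c = coeff s t
    cancels : ∀ i → t ≤ i → - (c * coeff b i) + coeff s i ≡ 0#
    cancels i t≤i with ℕₚ.m≤n⇒m<n∨m≡n t≤i
    ... | inj₂ ≡.refl = begin
      - (c * coeff b t) + c  ≡⟨ cong (λ x → - (c * x) + c) (leading≡1 mb) ⟩
      - (c * 1#) + c         ≡⟨ cong (λ x → - x + c) (*-identityʳ c) ⟩
      - c + c                ≡⟨ -‿inverseˡ c ⟩
      0#                     ∎
    ... | inj₁ t<i    = begin
      - (c * coeff b i) + coeff s i  ≡⟨ cong₂ (λ x y → - (c * x) + y) (vanishes (deg<1+ mb) i t<i) (vanishes s<1+t i t<i) ⟩
      - (c * 0#) + 0#                ≡⟨ cong (λ x → - x + 0#) (zeroʳ c) ⟩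
      - 0# + 0#                      ≡⟨ -‿inverseˡ 0# ⟩
      0#                             ∎

  -- Horner's scheme: divide the tail of a first; one multiple of b then cancels the new top coefficient.
  divide : ∀ {t b} → Monic t b → ∀ a → Division t a b
  divide mb [] = record { quotient = 0ₚ ; remainder = 0ₚ ; a≋qb+r = ≋-refl ; remainder<t = deg< λ _ _ → ≡.refl }
  divide {t} {b} mb (a ∷ p) = record
    { quotient    = c ∷ Q
    ; remainder   = (-ₚ scale c b) +ₚ (a ∷ r)
    ; a≋qb+r      = begin
        a ∷ p
          ≈⟨ ∷-cong (≡.sym (+-identityˡ a)) p≋Qb+r ⟩
        (0# ∷ (Q *ₚ b)) +ₚ (a ∷ r)
          ≈⟨ +ₚ-cong (≋-refl {0# ∷ (Q *ₚ b)}) (\\-leftDividesˡ (scale c b) (a ∷ r)) ⟨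
        (0# ∷ (Q *ₚ b)) +ₚ (scale c b +ₚ ((-ₚ scale c b) +ₚ (a ∷ r)))
          ≈⟨ x∙yz≈yx∙z (0# ∷ (Q *ₚ b)) (scale c b) _ ⟩
        (scale c b +ₚ (0# ∷ (Q *ₚ b))) +ₚ ((-ₚ scale c b) +ₚ (a ∷ r)) ∎
    ; remainder<t = cancel-top mb (∷-Deg< r<t) }
    where
    open Division (divide mb p) renaming (quotient to Q; remainder to r; a≋qb+r to p≋Qb+r; remainder<t to r<t)
    open import Relation.Binary.Reasoning.Setoid ≋-setoid
    c = coeff (a ∷ r) t

  Division-exact : ∀ {t a b} (d : Division t a b) → Division.remainder d ≋ 0ₚ → b ∣ˡ a
  Division-exact {a = a} {b} d r≋0 = quotient , ≋-sym (begin
    a                           ≈⟨ a≋qb+r ⟩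
    (quotient *ₚ b) +ₚ remainder ≈⟨ +ₚ-cong ≋-refl r≋0 ⟩
    (quotient *ₚ b) +ₚ 0ₚ        ≈⟨ +ₚ-identityʳ _ ⟩
    quotient *ₚ b               ≈⟨ *ₚ-comm quotient b ⟩
    b *ₚ quotient               ∎)
    where
    open Division d
    open import Relation.Binary.Reasoning.Setoid ≋-setoid

module PolynomialIdeals {q : ℕ} (F : FiniteField q) where

  open import Data.Nat using (zero; suc; _<_)
  open import Data.Nat.Induction using (<-rec)
  open import Data.Fin using (Fin; zero; suc)
  open import Data.List using ([]; _∷_)
  open import Data.Product using (∃-syntax; _,_)
  open import Data.Sum using (_⊎_; inj₁; inj₂)
  open import Function.Base using (_∘_)
  open import Algebra.Bundles using (CommutativeRing)

  open PolyOver F using (Poly; _+ₚ_; scale; _*ₚ_)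
  open PolynomialRing F
  open PolynomialDegree F
  open import Algebra.Properties.Ring (CommutativeRing.ring polynomialRing) using (\\-leftDividesʳ)
  open import Algebra.Properties.CommutativeSemigroup (CommutativeRing.*-commutativeSemigroup polynomialRing)
    using () renaming (x∙yz≈y∙xz to *ₚ-left-commute)

  all-or-some : ∀ {n} {A B : Fin n → Set} → (∀ i → A i ⊎ B i) → (∀ i → A i) ⊎ ∃[ i ] B i
  all-or-some {zero}  A⊎B = inj₁ λ ()
  all-or-some {suc n} A⊎B with A⊎B zero | all-or-some (A⊎B ∘ suc)
  ... | inj₂ B₀ | _             = inj₂ (zero , B₀)
  ... | inj₁ _  | inj₂ (i , Bᵢ) = inj₂ (suc i , Bᵢ)
  ... | inj₁ A₀ | inj₁ A₊       = inj₁ λ { zero → A₀ ; (suc i) → A₊ i }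

  infix 4 _∈⟨_⟩
  data _∈⟨_⟩ {n : ℕ} : Poly → (Fin n → Poly) → Set where
    gen      : ∀ {P} i → P i ∈⟨ P ⟩
    +-closed : ∀ {P x y} → x ∈⟨ P ⟩ → y ∈⟨ P ⟩ → x +ₚ y ∈⟨ P ⟩
    *-closed : ∀ {P x} s → x ∈⟨ P ⟩ → s *ₚ x ∈⟨ P ⟩
    ≋-closed : ∀ {P x y} → x ≋ y → x ∈⟨ P ⟩ → y ∈⟨ P ⟩

  ∣ˡ-+ₚ : ∀ {h x y} → h ∣ˡ x → h ∣ˡ y → h ∣ˡ x +ₚ y
  ∣ˡ-+ₚ {h} (u , hu≋x) (v , hv≋y) = u +ₚ v , ≋-trans (*ₚ-distribˡ h u v) (+ₚ-cong hu≋x hv≋y)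

  ∈⟨⟩-common-divisor : ∀ {n h x} {P : Fin n → Poly} → (∀ i → h ∣ˡ P i) → x ∈⟨ P ⟩ → h ∣ˡ x
  ∈⟨⟩-common-divisor h∣P (gen i)                 = h∣P i
  ∈⟨⟩-common-divisor h∣P (+-closed x∈ y∈)        = ∣ˡ-+ₚ (∈⟨⟩-common-divisor h∣P x∈) (∈⟨⟩-common-divisor h∣P y∈)
  ∈⟨⟩-common-divisor h∣P (*-closed {x = x} s x∈) = ∣ˡ-respʳ-≈ (*ₚ-comm x s) (x∣ˡy⇒x∣ˡyz s (∈⟨⟩-common-divisor h∣P x∈))
  ∈⟨⟩-common-divisor h∣P (≋-closed x≋y x∈)       = ∣ˡ-respʳ-≈ x≋y (∈⟨⟩-common-divisor h∣P x∈)

  ∈⟨⟩-*ₚ : ∀ {n h x} {P P' : Fin n → Poly} → (∀ i → h *ₚ P i ≋ P' i) → x ∈⟨ P ⟩ → h *ₚ x ∈⟨ P' ⟩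
  ∈⟨⟩-*ₚ hP≋P' (gen i) = ≋-closed (≋-sym (hP≋P' i)) (gen i)
  ∈⟨⟩-*ₚ {h = h} hP≋P' (+-closed {x = x} {y} x∈ y∈) =
    ≋-closed (≋-sym (*ₚ-distribˡ h x y)) (+-closed (∈⟨⟩-*ₚ {h = h} hP≋P' x∈) (∈⟨⟩-*ₚ {h = h} hP≋P' y∈))
  ∈⟨⟩-*ₚ {h = h} hP≋P' (*-closed {x = x} s x∈) =
    ≋-closed (*ₚ-left-commute s h x) (*-closed s (∈⟨⟩-*ₚ {h = h} hP≋P' x∈))
  ∈⟨⟩-*ₚ {h = h} hP≋P' (≋-closed x≋y x∈) = ≋-closed (*ₚ-congˡ h x≋y) (∈⟨⟩-*ₚ {h = h} hP≋P' x∈)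

  ∈⟨⟩-scale : ∀ {n x} {P : Fin n → Poly} c → x ∈⟨ P ⟩ → scale c x ∈⟨ P ⟩
  ∈⟨⟩-scale {x = x} c x∈ = ≋-closed (constant-*ₚ x ≋-refl) (*-closed (c ∷ []) x∈)

  ∈⟨⟩-remainder : ∀ {n t a b} {P : Fin n → Poly} → a ∈⟨ P ⟩ → b ∈⟨ P ⟩ → (d : Division t a b) →
                  Division.remainder d ∈⟨ P ⟩
  ∈⟨⟩-remainder {a = a} {b} a∈ b∈ d = ≋-closed r≋ (+-closed (∈⟨⟩-scale (- 1#) (*-closed quotient b∈)) a∈)
    where
    open Division d
    r≋ : (-ₚ (quotient *ₚ b)) +ₚ a ≋ remainder
    r≋ = ≋-trans (+ₚ-cong ≋-refl a≋qb+r) (\\-leftDividesʳ (quotient *ₚ b) remainder)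

  record MonicGenerator {n : ℕ} (P : Fin n → Poly) : Set where
    field
      degree     : ℕ
      generator  : Poly
      isMonic    : Monic degree generator
      generator∈ : generator ∈⟨ P ⟩
      generator∣ : ∀ i → generator ∣ˡ P i

  -- Euclid's algorithm: divide every P i by a monic g of the ideal; either all remainders vanish,
  -- or some remainder, made monic, is an element of the ideal of smaller degree.
  monicGenerator : ∀ {n k g} (P : Fin n → Poly) → Monic k g → g ∈⟨ P ⟩ → MonicGenerator P
  monicGenerator {k = k} P = <-rec (λ k → ∀ {g} → Monic k g → g ∈⟨ P ⟩ → MonicGenerator P) step k
    where
    step : ∀ k → (∀ {t} → t < k → ∀ {g} → Monic t g → g ∈⟨ P ⟩ → MonicGenerator P) →
           ∀ {g} → Monic k g → g ∈⟨ P ⟩ → MonicGenerator P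
    step k rec {g} mg g∈ with all-or-some (λ i → ≋0ₚ⊎HasDegree (Division.remainder (divide mg (P i))))
    ... | inj₁ remainders≋0 = record
      { degree = k ; generator = g ; isMonic = mg ; generator∈ = g∈
      ; generator∣ = λ i → Division-exact (divide mg (P i)) (remainders≋0 i) }
    ... | inj₂ (i , t , r°t) = rec (degree<bound r°t (Division.remainder<t (divide mg (P i))))
                                   (normalise-Monic r°t) (∈⟨⟩-scale _ (∈⟨⟩-remainder (gen i) g∈ (divide mg (P i))))

module Columns {q : ℕ} (F : FiniteField q) where

  open import Data.Nat as ℕ using (zero; suc; _≤_; _<_; _<?_)
  import Data.Nat.Properties as ℕₚ
  open import Data.Fin using (Fin; zero; suc; toℕ; fromℕ<)
  open import Data.Fin.Properties using (toℕ-fromℕ<)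
  open import Data.Vec using (Vec; []; _∷_; lookup; tabulate; toList; map)
  open import Data.Vec.Properties using (lookup∘tabulate; lookup-map)
  open import Data.Vec.Relation.Binary.Pointwise.Extensional using (ext; Pointwise-≡⇒≡)
  open import Data.Product using (∃-syntax; _×_; _,_; proj₂)
  open import Function.Bundles using (_⇔_; mk⇔)
  open import Data.Sum using (inj₁; inj₂)
  open import Relation.Nullary using (yes; no)
  open import Relation.Binary.PropositionalEquality as ≡ using (_≡_; cong; subst)
  open import Function.Base using (_∘_; case_of_)

  open PolyOver F using (Poly; coeff; _*ₚ_; monic; entry)
  open PolynomialRing F
  open PolynomialDegree F
  open PolynomialIdeals F

  M : ℕ → ℕ → Set
  M n d = Vec (Vec (Fin q) n) d

  coeff-toList : ∀ {k} (v : Vec (Fin q) k) (i : Fin k) → coeff (toList v) (toℕ i) ≡ lookup v i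
  coeff-toList (a ∷ v) zero    = ≡.refl
  coeff-toList (a ∷ v) (suc i) = coeff-toList v i

  toList-Deg< : ∀ {k} (v : Vec (Fin q) k) → Deg< k (toList v)
  toList-Deg< []      = deg< λ _ _ → ≡.refl
  toList-Deg< (a ∷ v) = ∷-Deg< (toList-Deg< v)

  coeff-monic : ∀ {k} (v : Vec (Fin q) k) (i : Fin k) → coeff (monic v) (toℕ i) ≡ lookup v i
  coeff-monic (a ∷ v) zero    = ≡.refl
  coeff-monic (a ∷ v) (suc i) = coeff-monic v i

  monic-Monic : ∀ {k} (v : Vec (Fin q) k) → Monic k (monic v)
  monic-Monic []      = record { deg<1+ = deg< λ { (suc i) _ → ≡.refl } ; leading≡1 = ≡.refl }
  monic-Monic (a ∷ v) = record { deg<1+ = ∷-Deg< (deg<1+ (monic-Monic v)) ; leading≡1 = leading≡1 (monic-Monic v) }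

  Deg<-≋ : ∀ {d p p'} → Deg< d p → Deg< d p' → (∀ i → i < d → coeff p i ≡ coeff p' i) → p ≋ p'
  Deg<-≋ {d} {p} {p'} p<d p'<d agree = coeffwise agree-everywhere
    where
    agree-everywhere : ∀ i → coeff p i ≡ coeff p' i
    agree-everywhere i with i <? d
    ... | yes i<d = agree i i<d
    ... | no  i≮d = ≡.trans (vanishes p<d i (ℕₚ.≮⇒≥ i≮d)) (≡.sym (vanishes p'<d i (ℕₚ.≮⇒≥ i≮d)))

  Monic-≋ : ∀ {d p p'} → Monic d p → Monic d p' → (∀ i → i < d → coeff p i ≡ coeff p' i) → p ≋ p'
  Monic-≋ mp mp' agree = Deg<-≋ (deg<1+ mp) (deg<1+ mp') λ i i<1+d →
    case ℕₚ.m≤n⇒m<n∨m≡n (ℕₚ.≤-pred i<1+d) of λ where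
      (inj₁ i<d)    → agree i i<d
      (inj₂ ≡.refl) → ≡.trans (leading≡1 mp) (≡.sym (leading≡1 mp'))

  fin-agree : ∀ {d} {p p' : Poly} → (∀ (i : Fin d) → coeff p (toℕ i) ≡ coeff p' (toℕ i)) →
              ∀ i → i < d → coeff p i ≡ coeff p' i
  fin-agree {p = p} {p'} agree i i<d = subst (λ j → coeff p j ≡ coeff p' j) (toℕ-fromℕ< i<d) (agree (fromℕ< i<d))

  EntryShape : ∀ {n} → ℕ → Fin n → Poly → Set
  EntryShape d zero    = Monic d
  EntryShape d (suc _) = Deg< d

  EntryShape-≋ : ∀ {n d p p'} (k : Fin n) → EntryShape d k p → EntryShape d k p' →
                 (∀ (i : Fin d) → coeff p (toℕ i) ≡ coeff p' (toℕ i)) → p ≋ p'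
  EntryShape-≋ {p = p} {p'} zero    mp  mp'  = Monic-≋ mp mp' ∘ fin-agree {p = p} {p'}
  EntryShape-≋ {p = p} {p'} (suc k) p<d p'<d = Deg<-≋ p<d p'<d ∘ fin-agree {p = p} {p'}

  entry-EntryShape : ∀ {n d} (C : M n d) k → EntryShape d k (entry C k)
  entry-EntryShape C zero    = monic-Monic _
  entry-EntryShape C (suc k) = toList-Deg< _

  coeff-entry : ∀ {n d} (C : M n d) k (i : Fin d) → coeff (entry C k) (toℕ i) ≡ lookup (lookup C i) k
  coeff-entry C zero    i = ≡.trans (coeff-monic (map (λ Cᵢ → lookup Cᵢ zero) C) i) (lookup-map i _ C)
  coeff-entry C (suc k) i = ≡.trans (coeff-toList (map (λ Cᵢ → lookup Cᵢ (suc k)) C) i) (lookup-map i _ C)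

  entry-injective : ∀ {n d} {C C' : M n d} → (∀ k → entry C k ≋ entry C' k) → C ≡ C'
  entry-injective {C = C} {C'} C≋C' = Pointwise-≡⇒≡ (ext λ i → Pointwise-≡⇒≡ (ext λ k →
    ≡.trans (≡.sym (coeff-entry C k i)) (≡.trans (coeff-≡ (C≋C' k) (toℕ i)) (coeff-entry C' k i))))

  fromEntries : ∀ {n} d → (Fin n → Poly) → M n d
  fromEntries d P = tabulate λ i → tabulate λ k → coeff (P k) (toℕ i)

  entry-fromEntries : ∀ {n d} (P : Fin n → Poly) → (∀ k → EntryShape d k (P k)) → ∀ k → entry (fromEntries d P) k ≋ P k
  entry-fromEntries {d = d} P P-shape k = EntryShape-≋ k (entry-EntryShape (fromEntries d P) k) (P-shape k) λ i →
    ≡.trans (coeff-entry (fromEntries d P) k i)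
      (≡.trans (cong (λ v → lookup v k) (lookup∘tabulate _ i)) (lookup∘tabulate _ k))

  coefficients : (k : ℕ) → Poly → Vec (Fin q) k
  coefficients k p = tabulate λ i → coeff p (toℕ i)

  monic-coefficients : ∀ {k p} → Monic k p → monic (coefficients k p) ≋ p
  monic-coefficients {k} {p} mp = Monic-≋ (monic-Monic _) mp (fin-agree {p = monic (coefficients k p)} {p} λ i →
    ≡.trans (coeff-monic (coefficients k p) i) (lookup∘tabulate (coeff p ∘ toℕ) i))

  monic-injective : ∀ {k} {v v' : Vec (Fin q) k} → monic v ≋ monic v' → v ≡ v'
  monic-injective {v = v} {v'} v≋v' = Pointwise-≡⇒≡ (ext λ i →
    ≡.trans (≡.sym (coeff-monic v i)) (≡.trans (coeff-≡ v≋v' (toℕ i)) (coeff-monic v' i)))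

  infixr 7 _·_
  _·_ : ∀ {n k j} → Vec (Fin q) k → M n j → M n (k ℕ.+ j)
  h · r = fromEntries _ λ i → monic h *ₚ entry r i

  entry-· : ∀ {n k j} (h : Vec (Fin q) k) (r : M n j) i → entry (h · r) i ≋ monic h *ₚ entry r i
  entry-· h r = entry-fromEntries _ shape
    where
    shape : ∀ i → EntryShape _ i (monic h *ₚ entry r i)
    shape zero    = Monic-*ₚ-Monic (monic-Monic h) (entry-EntryShape r zero)
    shape (suc i) = *ₚ-Deg< (deg<1+ (monic-Monic h)) (entry-EntryShape r (suc i))

  ·-cancelˡ : ∀ {n k j} (h : Vec (Fin q) k) {r r' : M n j} → h · r ≡ h · r' → r ≡ r'
  ·-cancelˡ h {r} {r'} hr≡hr' = entry-injective λ i → Monic-*ₚ-cancelˡ (monic-Monic h)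
    (≋-trans (≋-sym (entry-· h r i)) (≋-trans (≡⇒≋ (cong (λ C → entry C i) hr≡hr')) (entry-· h r' i)))

  factor : ∀ {n k j} (h : Vec (Fin q) k) (C : M n (k ℕ.+ j)) → (∀ i → monic h ∣ˡ entry C i) → ∃[ r ] h · r ≡ C
  factor {n} {k} {j} h C h∣C = r , entry-injective λ i →
    ≋-trans (entry-· h r i) (≋-trans (*ₚ-congˡ (monic h) (entry-fromEntries u u-shape i)) (_∣ˡ_.equality (h∣C i)))
    where
    u : Fin n → Poly
    u i = _∣ˡ_.quotient (h∣C i)
    u-shape : ∀ i → EntryShape j i (u i)
    u-shape zero    = quotient-Monic (monic-Monic h) (_∣ˡ_.equality (h∣C zero)) (entry-EntryShape C zero)
    u-shape (suc i) = quotient-Deg< (monic-Monic h) (_∣ˡ_.equality (h∣C (suc i))) (entry-EntryShape C (suc i))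
    r = fromEntries j u

  IsGcd : ∀ {n d} → Poly → M n d → Set
  IsGcd g C = (∀ k → g ∣ˡ entry C k) × (∀ h → (∀ k → h ∣ˡ entry C k) → h ∣ˡ g)

  Coprime : ∀ {n d} → M n d → Set
  Coprime = IsGcd 1ₚ

  IsGcd-resp : ∀ {n d g g'} {C : M n d} → g ≋ g' → IsGcd g C → IsGcd g' C
  IsGcd-resp g≋g' (g∣C , g-greatest) = (∣ˡ-respˡ-≈ g≋g' ∘ g∣C) , λ h h∣C → ∣ˡ-respʳ-≈ g≋g' (g-greatest h h∣C)

  IsGcd-unique : ∀ {n d k k' g g'} {C : M n d} → Monic k g → Monic k' g' → IsGcd g C → IsGcd g' C → k ≡ k' × g ≋ g'
  IsGcd-unique mg mg' (g∣C , g-greatest) (g'∣C , g'-greatest) =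
    Monic-∣ˡ-antisym mg mg' (g'-greatest _ g∣C) (g-greatest _ g'∣C)

  columnGenerator : ∀ {n d} (C : M (suc n) d) → MonicGenerator (entry C)
  columnGenerator C = monicGenerator (entry C) (entry-EntryShape C zero) (gen zero)

  generator-IsGcd : ∀ {n d} (C : M (suc n) d) → IsGcd (MonicGenerator.generator (columnGenerator C)) C
  generator-IsGcd C = generator∣ , λ h h∣C → ∈⟨⟩-common-divisor h∣C generator∈
    where open MonicGenerator (columnGenerator C)

  gcd-exists : ∀ {n d} (C : M (suc n) d) → ∃[ k ] ∃[ h ] k ≤ d × IsGcd (monic {k} h) C
  gcd-exists C = degree , coefficients degree generator , Monic-∣ˡ-≤ isMonic (entry-EntryShape C zero) (generator∣ zero) ,
                 IsGcd-resp (≋-sym (monic-coefficients isMonic)) (generator-IsGcd C)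
    where open MonicGenerator (columnGenerator C)

  Coprime⇒IsGcd-· : ∀ {n k j} (h : Vec (Fin q) k) (r : M (suc n) j) → Coprime r → IsGcd (monic h) (h · r)
  Coprime⇒IsGcd-· h r (_ , 1-greatest) =
    (λ i → ∣ˡ-respʳ-≈ (≋-sym (entry-· h r i)) (x∣ˡxy (monic h) (entry r i))) ,
    λ e e∣hr → ∈⟨⟩-common-divisor e∣hr h∈
    where
    open MonicGenerator (columnGenerator r)
    generator≋1ₚ : generator ≋ 1ₚ
    generator≋1ₚ = proj₂ (Monic-∣ˡ-antisym isMonic (monic-Monic []) (1-greatest generator generator∣) (1ₚ∣ˡ generator))
    h∈ : monic h ∈⟨ entry (h · r) ⟩
    h∈ = ≋-closed (≋-trans (*ₚ-congˡ (monic h) generator≋1ₚ) (*ₚ-identityʳ (monic h)))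
                  (∈⟨⟩-*ₚ {h = monic h} (λ i → ≋-sym (entry-· h r i)) generator∈)

  IsGcd-·⇒Coprime : ∀ {n k j} (h : Vec (Fin q) k) (r : M n j) → IsGcd (monic h) (h · r) → Coprime r
  IsGcd-·⇒Coprime h r (_ , h-greatest) = 1ₚ∣ˡ ∘ entry r , e∣1ₚ
    where
    open import Relation.Binary.Reasoning.Setoid ≋-setoid
    e∣1ₚ : ∀ e → (∀ i → e ∣ˡ entry r i) → e ∣ˡ 1ₚ
    e∣1ₚ e e∣r with h-greatest (monic h *ₚ e) (λ i → ∣ˡ-respʳ-≈ (≋-sym (entry-· h r i)) (x∣ˡy⇒zx∣ˡzy (monic h) (e∣r i)))
    ... | w , he·w≋h = w , Monic-*ₚ-cancelˡ (monic-Monic h) (begin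
      monic h *ₚ (e *ₚ w)  ≈⟨ *ₚ-assoc (monic h) e w ⟨
      (monic h *ₚ e) *ₚ w  ≈⟨ he·w≋h ⟩
      monic h              ≈⟨ *ₚ-identityʳ (monic h) ⟨
      monic h *ₚ 1ₚ        ∎)

  IsGcd⇔factorisation : ∀ {n k j} (h : Vec (Fin q) k) (C : M (suc n) (k ℕ.+ j)) →
                        IsGcd (monic h) C ⇔ (∃[ r ] Coprime r × h · r ≡ C)
  IsGcd⇔factorisation h C = mk⇔
    (λ gcdC@(h∣C , _) → let r , hr≡C = factor h C h∣C in
      r , IsGcd-·⇒Coprime h r (subst (IsGcd (monic h)) (≡.sym hr≡C) gcdC) , hr≡C)
    (λ { (r , r-coprime , ≡.refl) → Coprime⇒IsGcd-· h r r-coprime })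

  ·-injective : ∀ {n k j} {h h' : Vec (Fin q) k} {r r' : M (suc n) j} →
                Coprime r → Coprime r' → h · r ≡ h' · r' → h ≡ h' × r ≡ r'
  ·-injective {h = h} {h'} {r} {r'} r-coprime r'-coprime hr≡h'r' =
    h≡h' , ·-cancelˡ h (≡.trans hr≡h'r' (cong (_· r') (≡.sym h≡h')))
    where
    h≡h' = monic-injective (proj₂ (IsGcd-unique (monic-Monic h) (monic-Monic h')
             (Coprime⇒IsGcd-· h r r-coprime) (subst (IsGcd (monic h')) (≡.sym hr≡h'r') (Coprime⇒IsGcd-· h' r' r'-coprime))))

  IsGcd⇔IsGcdOfEntries : ∀ {n d g} {C : M n d} → IsGcd g C ⇔ PolyOver.IsGcdOfEntries F g C
  IsGcd⇔IsGcdOfEntries = mk⇔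
    (λ (g∣C , g-greatest) → ∣ˡ⇒∣ₚ ∘ g∣C , λ h h∣C → ∣ˡ⇒∣ₚ (g-greatest h (∣ₚ⇒∣ˡ ∘ h∣C)))
    (λ (g∣C , g-greatest) → ∣ₚ⇒∣ˡ ∘ g∣C , λ h h∣C → ∣ₚ⇒∣ˡ (g-greatest h (∣ˡ⇒∣ₚ ∘ h∣C)))
    where
    ∣ˡ⇒∣ₚ : ∀ {a b} → a ∣ˡ b → PolyOver._∣ₚ_ F a b
    ∣ˡ⇒∣ₚ (u , au≋b) = u , coeff-≡ au≋b
    ∣ₚ⇒∣ˡ : ∀ {a b} → PolyOver._∣ₚ_ F a b → a ∣ˡ b
    ∣ₚ⇒∣ˡ (u , au≈b) = u , coeffwise au≈b

module CoprimeColumns {q : ℕ} (F : FiniteField q) (n : ℕ) where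

  open Counting
  open CoprimeCount

  open import Data.Nat as ℕ using (zero; suc; _*_; _^_; _∸_; _≤_; s≤s; NonZero)
  open import Data.Nat.Properties using (^-*-assoc; m∸n≤m; m+[n∸m]≡n; 0≢1+n; suc-injective)
  open import Data.Nat.Induction using (<-rec)
  open import Data.Fin as Fin using (Fin; toℕ; fromℕ<) renaming (_≟_ to _≟ᶠ_)
  open import Data.Fin.Properties using (nonZeroIndex; toℕ≤pred[n]; toℕ-fromℕ<; toℕ-injective)
  open import Data.Vec using (Vec; []; _∷_)
  open import Data.Vec.Properties using (≡-dec)
  open import Data.List using (_∷_)
  import Data.List as List
  open import Data.List.Relation.Unary.Any using (here)
  import Data.List.Relation.Unary.AllPairs as AllPairs
  open import Data.List.Relation.Unary.All using ([])
  open import Data.Product using (∃-syntax; _×_; _,_; proj₁; uncurry)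
  open import Data.Unit using (⊤; tt)
  open import Data.Empty using (⊥-elim)
  open import Relation.Nullary using (¬_)
  open import Relation.Binary.PropositionalEquality as ≡ using (_≡_; cong; cong₂; subst)
  open import Function.Base using (_∘_)
  open import Function.Bundles using (_⇔_; mk⇔; Equivalence)
  import Function.Properties.Equivalence as ⇔
  open import Algebra.Properties.Semiring.Sum Data.Nat.Properties.+-*-semiring using (sum-syntax)

  open PolyOver F using (monic)
  open PolynomialRing F using (1ₚ∣ˡ)
  open Columns F
  open Equivalence using (to; from)

  private instance
    q-nonZero : NonZero q
    q-nonZero = nonZeroIndex (FiniteField.0# F)

  f : ℕ → ℕ
  f = coprimeCount q (suc n)

  count-M : ∀ d → IsCount {M (suc n) d} (λ _ → ⊤) (q ^ (suc n * d))
  count-M d = subst (IsCount _) (^-*-assoc q (suc n) d) (IsCount-Vec (IsCount-Vec (IsCount-Fin q) (suc n)) d)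

  count-IsGcd : ∀ {k j N} (h : Vec (Fin q) k) → IsCount (Coprime {suc n} {j}) N → IsCount (IsGcd (monic h)) N
  count-IsGcd h count-coprime =
    IsCount-resp (λ C → ⇔.sym (IsGcd⇔factorisation h C)) (IsCount-image (h ·_) count-coprime (λ _ _ → ·-cancelˡ h))

  count-gcd-degree : ∀ k {j N} → IsCount (Coprime {suc n} {j}) N → IsCount (λ C → ∃[ h ] IsGcd (monic {k} h) C) (q ^ k * N)
  count-gcd-degree k {j} count-coprime =
    IsCount-resp factorisations
      (IsCount-image (uncurry _·_) (IsCount-× (IsCount-Vec (IsCount-Fin q) k) count-coprime)
        λ (_ , r-coprime) (_ , r'-coprime) → uncurry (cong₂ _,_) ∘ ·-injective r-coprime r'-coprime)
    where
    factorisations : ∀ C → (∃[ (h , r) ] (⊤ × Coprime r) × h · r ≡ C) ⇔ (∃[ h ] IsGcd (monic h) C)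
    factorisations C = mk⇔
      (λ ((h , r) , (_ , r-coprime) , hr≡C) → h , from (IsGcd⇔factorisation h C) (r , r-coprime , hr≡C))
      (λ (h , gcd) → let r , r-coprime , hr≡C = to (IsGcd⇔factorisation h C) gcd in (h , r) , (tt , r-coprime) , hr≡C)

  Coprime-[] : Coprime {suc n} {0} []
  Coprime-[] = (λ k → 1ₚ∣ˡ _) , λ h h∣[] → h∣[] Fin.zero

  count-coprime-zero : IsCount (Coprime {suc n} {0}) 1
  count-coprime-zero =
    [] ∷ List.[] , [] AllPairs.∷ AllPairs.[] , ≡.refl , λ { [] → mk⇔ (λ _ → here ≡.refl) (λ _ → Coprime-[]) }

  NonCoprime : ∀ m → M (suc n) (suc m) → Set
  NonCoprime m C = ∃[ k ] ∃[ h ] IsGcd (monic {suc (toℕ {suc m} k)} h) C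

  Coprime⇔¬NonCoprime : ∀ m (C : M (suc n) (suc m)) → Coprime C ⇔ (¬ NonCoprime m C)
  Coprime⇔¬NonCoprime m C = mk⇔
    (λ coprime (k , h , gcd) → 0≢1+n (proj₁ (IsGcd-unique (monic-Monic []) (monic-Monic h) coprime gcd)))
    (λ ¬non-coprime → from-gcd ¬non-coprime (gcd-exists C))
    where
    from-gcd : ¬ NonCoprime m C → ∃[ k ] ∃[ h ] k ≤ suc m × IsGcd (monic {k} h) C → Coprime C
    from-gcd _            (zero  , [] , _    , gcd) = gcd
    from-gcd ¬non-coprime (suc k , h  , k<1+m , gcd) = ⊥-elim (¬non-coprime (fromℕ< k<1+m ,
      subst (λ k → ∃[ h ] IsGcd (monic {suc k} h) C) (≡.sym (toℕ-fromℕ< k<1+m)) (h , gcd)))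

  IsCount-cast : ∀ {k d N} (P : ∀ {d} → M (suc n) d → Set) → k ≤ d → IsCount (P {k ℕ.+ (d ∸ k)}) N → IsCount (P {d}) N
  IsCount-cast P k≤d = subst (λ d → IsCount (P {d}) _) (m+[n∸m]≡n k≤d)

  count-NonCoprime : ∀ m → (∀ (k : Fin (suc m)) → IsCount (Coprime {suc n} {m ∸ toℕ k}) (f (m ∸ toℕ k))) →
                     IsCount (NonCoprime m) (∑[ k < suc m ] (q ^ suc (toℕ k) * f (m ∸ toℕ k)))
  count-NonCoprime m count-coprime = IsCount-∃
    (λ k → IsCount-cast (λ C → ∃[ h ] IsGcd (monic {suc (toℕ k)} h) C) (s≤s (toℕ≤pred[n] k))
             (count-gcd-degree (suc (toℕ k)) (count-coprime k)))
    λ (h , gcd) (h' , gcd') →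
      toℕ-injective (suc-injective (proj₁ (IsGcd-unique (monic-Monic h) (monic-Monic h') gcd gcd')))

  count-coprime : ∀ d → IsCount (Coprime {suc n} {d}) (f d)
  count-coprime = <-rec (λ d → IsCount Coprime (f d)) λ where
    zero    _   → count-coprime-zero
    (suc m) rec →
      subst (IsCount Coprime) (cong (q ^ (suc n * suc m) ∸_) (shifted-convolution q (suc n) m))
        (IsCount-resp (λ C → ⇔.sym (Coprime⇔¬NonCoprime m C))
          (IsCount-∁ (≡-dec (≡-dec _≟ᶠ_)) (count-M (suc m)) (count-NonCoprime m λ k → rec (s≤s (m∸n≤m m (toℕ k))))))

  count-IsGcdOfEntries : ∀ {d δ} (c : Vec (Fin q) δ) → δ ≤ d →
                         IsCount (λ (C : M (suc n) d) → PolyOver.IsGcdOfEntries F (monic c) C) (f (d ∸ δ))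
  count-IsGcdOfEntries c δ≤d = IsCount-resp (λ _ → IsGcd⇔IsGcdOfEntries)
    (IsCount-cast (IsGcd (monic c)) δ≤d (count-IsGcd c (count-coprime _)))

open import Data.Nat using (ℕ; _≤_; _<_; _*_; _+_; _∸_; _^_; suc; s≤s; z≤n)
open import Data.Nat.Properties using (m<n⇒0<n∸m; n∸n≡0)
open import Data.Fin using (Fin)
open import Data.Vec using (Vec)
open import Data.Product using (_×_; _,_)
open import Relation.Binary.PropositionalEquality using (_≡_; refl; cong; subst)
open CoprimeCount using (coprimeCount; coprimeCount-nonzero)

corollary4p7 : (q : ℕ) (F : FiniteField q) (n d δ : ℕ) → 1 ≤ n → 1 ≤ d
    → (c : Vec (Fin q) δ) → δ ≤ d
    → (δ < d → IsCount (λ (C : Vec (Vec (Fin q) n) d) → PolyOver.IsGcdOfEntries F (PolyOver.monic F c) C)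
                 (q ^ (n * (d ∸ δ)) ∸ q ^ (n * (d ∸ δ ∸ 1) + 1)))
      × (δ ≡ d → IsCount (λ (C : Vec (Vec (Fin q) n) d) → PolyOver.IsGcdOfEntries F (PolyOver.monic F c) C) 1)
corollary4p7 q F (suc n) d δ (s≤s z≤n) _ c δ≤d =
  (λ δ<d → subst (IsCount _) (coprimeCount-nonzero q (suc n) (m<n⇒0<n∸m δ<d)) count) ,
  (λ { refl → subst (IsCount _) (cong (coprimeCount q (suc n)) (n∸n≡0 d)) count })
  where
  count = CoprimeColumns.count-IsGcdOfEntries F n c δ≤d
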